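{- Let $(W,S)$ be an arbitrary Coxeter system with $S=\{s_0,\ldots,s_n\}$. If $w<w'$ in the (strong) Bruhat order on $W$, then $\nu(w)\le\nu(w')$. In particular: (i) for any $s\in S$ and $w\in W$, if $\ell_S(ws)<\ell_S(w)$ then $\nu(ws)\le\nu(w)$; (ii) for $w,w'\in W^+$, if $w<w'$ in the Bruhat order on $W$ then $\ell_{R\cup R^{ -1}}(w)\le\ell_{R\cup R^{ -1}}(w')$.
   Context: $\ell_S$ is Coxeter length. For $w\in W$, $\nu(w)$ is the minimum number of letters different from $s_0$ in any word in $S$ factoring $w$. $W^+=\ker\epsilon$ ($\epsilon(s)=-1$ for $s\in S$), generated by $R=\{r_i=s_0s_i:1\le i\le n\}$; $\ell_{R\cup R^{ -1}}$ is word length on $W^+$ w.r.t. $R\cup R^{ -1}$. -}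

module Defs where

open import Data.Nat using (ℕ; zero; suc; _<_; _≤_)
open import Data.Nat.Properties using ()
open import Data.Fin using (Fin; zero; suc)
open import Data.List using (List; []; _∷_; _++_; length; reverse; map; concat)
open import Data.Bool using (Bool; true; false)
open import Data.Product using (Σ; _×_; _,_)
open import Relation.Binary.PropositionalEquality using (_≡_; _≢_)
open import Relation.Binary.Construct.Closure.Transitive using (TransClosure)

-- Coxeter matrix on S = {s_0, …, s_n} (indices Fin (suc n)); entry 0 encodes ∞.
record CoxeterMatrix (n : ℕ) : Set where
  field
    m      : Fin (suc n) → Fin (suc n) → ℕ
    m-diag : ∀ i → m i i ≡ 1
    m-sym  : ∀ i j → m i j ≡ m j i
    m-off  : ∀ i j → i ≢ j → m i j ≢ 1

module Coxeter {n : ℕ} (M : CoxeterMatrix n) where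
  open CoxeterMatrix M

  Word : Set
  Word = List (Fin (suc n))

  alt : Fin (suc n) → Fin (suc n) → ℕ → Word
  alt i j zero    = []
  alt i j (suc k) = i ∷ alt j i k

  -- equality in W = ⟨ S | s² = 1, (s t)^{m(s,t)} = 1 ⟩ (m = 0 meaning no relation),
  -- as the congruence on words generated by s s = 1 and the braid relations.
  infix 4 _≈_
  data _≈_ : Word → Word → Set where
    ≈-refl  : ∀ {u} → u ≈ u
    ≈-sym   : ∀ {u v} → u ≈ v → v ≈ u
    ≈-trans : ∀ {u v w} → u ≈ v → v ≈ w → u ≈ w
    cancel  : ∀ u i v → (u ++ i ∷ i ∷ v) ≈ (u ++ v)
    braid   : ∀ u i j v → 0 < m i j →
              (u ++ alt i j (m i j) ++ v) ≈ (u ++ alt j i (m i j) ++ v)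

  IsMin : (ℕ → Set) → ℕ → Set
  IsMin P k = P k × (∀ j → P j → k ≤ j)

  Len : Word → ℕ → Set
  Len w = IsMin (λ k → Σ Word (λ v → v ≈ w × length v ≡ k))

  LenLt : Word → Word → Set
  LenLt u v = Σ ℕ (λ a → Σ ℕ (λ b → Len u a × Len v b × a < b))

  countNon0 : Word → ℕ
  countNon0 []            = 0
  countNon0 (zero  ∷ v)   = countNon0 v
  countNon0 (suc _ ∷ v)   = suc (countNon0 v)

  Nu : Word → ℕ → Set
  Nu w = IsMin (λ k → Σ Word (λ v → v ≈ w × countNon0 v ≡ k))

  reflection : Word → Fin (suc n) → Word
  reflection x s = x ++ s ∷ reverse x

  BruhatStep : Word → Word → Set
  BruhatStep u v = Σ Word (λ x → Σ (Fin (suc n)) (λ s →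
                     (v ≈ u ++ reflection x s) × LenLt u v))

  BruhatLt : Word → Word → Set
  BruhatLt = TransClosure BruhatStep

  -- W⁺ = ker ε : elements represented by words of even length
  data Even : ℕ → Set where
    even-zero : Even 0
    even-ss   : ∀ {k} → Even k → Even (suc (suc k))

  InWplus : Word → Set
  InWplus w = Even (length w)

  -- letters of R ∪ R⁻¹ : (i , true) = r_{i+1} = s_0 s_{i+1},
  --                      (i , false) = r_{i+1}⁻¹ = s_{i+1} s_0,  for i : Fin n
  RLetter : Set
  RLetter = Fin n × Bool

  expandR : RLetter → Word
  expandR (i , true)  = zero ∷ suc i ∷ []
  expandR (i , false) = suc i ∷ zero ∷ []

  expandRWord : List RLetter → Word
  expandRWord ls = concat (map expandR ls)

  LenR : Word → ℕ → Set
  LenR w = IsMin (λ k → Σ (List RLetter) (λ ls → expandRWord ls ≈ w × length ls ≡ k))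

{-# OPTIONS --safe #-}
module Submission where

-- For a word v = s₁ ⋯ sₖ let t₁, …, tₖ be the reflections with v tᵢ = s₁ ⋯ ŝᵢ ⋯ sₖ, and let η(v, t)
-- be the parity of the number of i with tᵢ = t in W. As Tits observed, η(v, t) depends only on the
-- element of W represented by v: cancelling s s removes two equal tᵢ, and a braid relation reverses
-- the list of tᵢ of the alternating word it replaces. Moreover η(t, t) = 1 for every reflection t.
-- Now let ℓ(u) < ℓ(u t) and let r be a reduced word for u. Then η(r, t) = 0, for otherwise deleting a
-- letter of r would give a word for u t shorter than r. Hence η(v, t) = η(r t, t) = 1 for every word
-- v of u t, and deleting the letter of v at such an i leaves a subword of v representing u. Along a
-- chain, every word for w′ thus contains a subword for w whenever w < w′, so ν(w) ≤ ν(w′). On W⁺,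
-- pairing up the letters of a word shows that ℓ_{R∪R⁻¹} = ν.

open import Defs
open import Level using (0ℓ; _⊔_)
open import Data.Nat using (ℕ; zero; suc; _+_; _≤_; _<_; _≤?_; z≤n; s≤s; parity)
open import Data.Nat.Properties using (≤-refl; ≤-trans; m≤n⇒m≤1+n; <-asym; +-suc; +-comm; module ≤-Reasoning)
open import Data.Parity.Base as ℙ using (Parity; 0ℙ; 1ℙ)
import Data.Parity.Properties as ℙ
open import Data.Fin using (Fin; zero; suc)
open import Data.Bool using (true; false)
open import Data.List
  using (List; []; _∷_; _++_; length; reverse; map; applyUpTo; applyDownFrom)
open import Data.List.Properties
  using (++-assoc; ++-identityʳ; unfold-reverse; reverse-++; reverse-involutive; reverse-map;
         reverse-applyUpTo; map-∘; map-applyUpTo; length-++; length-++-sucʳ; concatMap-++)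
open import Data.List.Relation.Unary.Any using (Any; here; there)
open import Data.List.Relation.Binary.Pointwise as Pointwise using (Pointwise; []; _∷_)
open import Data.List.Relation.Binary.Sublist.Propositional using (_⊆_; []; _∷_; _∷ʳ_; ⊆-refl; ⊆-trans)
open import Data.Product using (∃; ∃₂; _×_; _,_)
open import Function using (_∘_; _⇔_; mk⇔; Equivalence)
open import Relation.Binary.Bundles using (Setoid)
open import Relation.Binary.Construct.Closure.Transitive using ([_]; _∷_)
open import Relation.Binary.PropositionalEquality
  using (_≡_; refl; sym; trans; cong; cong₂; subst; subst₂; module ≡-Reasoning)
import Relation.Binary.Reasoning.Setoid as SetoidReasoning
open import Data.Nat.Solver using (module +-*-Solver)
open import Relation.Nullary using (¬_; yes; no)
open import Relation.Nullary.Decidable using (¬¬-excluded-middle; decidable-stable)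
open import Relation.Nullary.Negation using (contradiction)

module OccurrenceParity {a ℓ} (S : Setoid a ℓ) where
  open Setoid S using (_≈_) renaming (Carrier to A; sym to ≈-sym; trans to ≈-trans)

  private variable
    t x y : A
    xs ys xs′ ys′ : List A
    p q : Parity

  -- p is the parity of the number of entries of xs equivalent to t; a relation, as _≈_ need not
  -- be decidable.
  data ParityOf (t : A) : List A → Parity → Set (a ⊔ ℓ) where
    []   : ParityOf t [] 0ℙ
    hit  : t ≈ x → ParityOf t xs p → ParityOf t (x ∷ xs) (1ℙ ℙ.+ p)
    miss : ¬ t ≈ x → ParityOf t xs p → ParityOf t (x ∷ xs) p

  parityOf-functional : ParityOf t xs p → ParityOf t xs q → p ≡ q
  parityOf-functional []           []           = refl
  parityOf-functional (hit _ P)    (hit _ Q)    = cong (1ℙ ℙ.+_) (parityOf-functional P Q)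
  parityOf-functional (hit t≈x _)  (miss t≉x _) = contradiction t≈x t≉x
  parityOf-functional (miss t≉x _) (hit t≈x _)  = contradiction t≈x t≉x
  parityOf-functional (miss _ P)   (miss _ Q)   = parityOf-functional P Q

  parityOf-¬¬exists : ∀ t xs → ¬ ¬ ∃ (ParityOf t xs)
  parityOf-¬¬exists t []       k = k (0ℙ , [])
  parityOf-¬¬exists t (x ∷ xs) k = parityOf-¬¬exists t xs λ (p , P) → ¬¬-excluded-middle λ where
    (yes t≈x) → k (1ℙ ℙ.+ p , hit t≈x P)
    (no t≉x)  → k (p , miss t≉x P)

  parityOf-++⁺ : ParityOf t xs p → ParityOf t ys q → ParityOf t (xs ++ ys) (p ℙ.+ q)
  parityOf-++⁺ []                  Q = Q
  parityOf-++⁺ (hit {p = p} t≈x P) Q =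
    subst (ParityOf _ _) (sym (ℙ.+-assoc 1ℙ p _)) (hit t≈x (parityOf-++⁺ P Q))
  parityOf-++⁺ (miss t≉x P)        Q = miss t≉x (parityOf-++⁺ P Q)

  parityOf-++⁻ : ∀ xs → ParityOf t (xs ++ ys) p →
                 ∃₂ λ q r → ParityOf t xs q × ParityOf t ys r × p ≡ q ℙ.+ r
  parityOf-++⁻ []       P            = 0ℙ , _ , [] , P , refl
  parityOf-++⁻ (x ∷ xs) (hit t≈x P)  with parityOf-++⁻ xs P
  ... | q , r , Q , R , p≡q+r =
    1ℙ ℙ.+ q , r , hit t≈x Q , R , trans (cong (1ℙ ℙ.+_) p≡q+r) (sym (ℙ.+-assoc 1ℙ q r))
  parityOf-++⁻ (x ∷ xs) (miss t≉x P) with parityOf-++⁻ xs P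
  ... | q , r , Q , R , p≡q+r = q , r , miss t≉x Q , R , p≡q+r

  parityOf-1ℙ⇒Any : ParityOf t xs 1ℙ → Any (t ≈_) xs
  parityOf-1ℙ⇒Any P = go P refl
    where
    go : ParityOf t xs p → p ≡ 1ℙ → Any (t ≈_) xs
    go []          ()
    go (hit t≈x _) _    = here t≈x
    go (miss _ P)  p≡1ℙ = there (go P p≡1ℙ)

  module _ {f : A → A} {t′ : A} (t≈f⇔t′≈ : ∀ x → t ≈ f x ⇔ t′ ≈ x) where
    open Equivalence

    parityOf-map⁺ : ParityOf t′ xs p → ParityOf t (map f xs) p
    parityOf-map⁺ []            = []
    parityOf-map⁺ (hit t′≈x P)  = hit (from (t≈f⇔t′≈ _) t′≈x) (parityOf-map⁺ P)
    parityOf-map⁺ (miss t′≉x P) = miss (λ t≈fx → t′≉x (to (t≈f⇔t′≈ _) t≈fx)) (parityOf-map⁺ P)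

    parityOf-map⁻ : ∀ xs → ParityOf t (map f xs) p → ParityOf t′ xs p
    parityOf-map⁻ []       []            = []
    parityOf-map⁻ (_ ∷ xs) (hit t≈fx P)  = hit (to (t≈f⇔t′≈ _) t≈fx) (parityOf-map⁻ xs P)
    parityOf-map⁻ (_ ∷ xs) (miss t≉fx P) =
      miss (λ t′≈x → t≉fx (from (t≈f⇔t′≈ _) t′≈x)) (parityOf-map⁻ xs P)

  infix 4 _≈ₚ_
  _≈ₚ_ : List A → List A → Set (a ⊔ ℓ)
  xs ≈ₚ ys = ∀ {t p} → ParityOf t xs p → ParityOf t ys p

  ≈ₚ-++ : xs ≈ₚ xs′ → ys ≈ₚ ys′ → xs ++ ys ≈ₚ xs′ ++ ys′
  ≈ₚ-++ {xs = xs} xs≈ₚxs′ ys≈ₚys′ P with parityOf-++⁻ xs P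
  ... | q , r , Q , R , p≡q+r =
    subst (ParityOf _ _) (sym p≡q+r) (parityOf-++⁺ (xs≈ₚxs′ Q) (ys≈ₚys′ R))

  ≈ₚ-reverse : xs ≈ₚ reverse xs
  ≈ₚ-reverse {[]}     [] = []
  ≈ₚ-reverse {x ∷ xs} P  = subst (λ zs → ParityOf _ zs _) (sym (unfold-reverse x xs)) (snoc P)
    where
    snoc : ParityOf t (x ∷ xs) p → ParityOf t (reverse xs ++ x ∷ []) p
    snoc (hit {p = p} t≈x P) =
      subst (ParityOf _ _) (ℙ.+-comm p 1ℙ) (parityOf-++⁺ (≈ₚ-reverse P) (hit t≈x []))
    snoc (miss t≉x P) =
      subst (ParityOf _ _) (ℙ.+-identityʳ _) (parityOf-++⁺ (≈ₚ-reverse P) (miss t≉x []))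

  ≈ₚ-Pointwise : Pointwise _≈_ xs ys → xs ≈ₚ ys
  ≈ₚ-Pointwise []             []           = []
  ≈ₚ-Pointwise (x≈y ∷ xs≈ys) (hit t≈x P)  = hit (≈-trans t≈x x≈y) (≈ₚ-Pointwise xs≈ys P)
  ≈ₚ-Pointwise (x≈y ∷ xs≈ys) (miss t≉x P) =
    miss (λ t≈y → t≉x (≈-trans t≈y (≈-sym x≈y))) (≈ₚ-Pointwise xs≈ys P)

  ≈ₚ-dropPair : x ≈ y → x ∷ y ∷ xs ≈ₚ xs
  ≈ₚ-dropPair x≈y (hit _ (hit {p = p} _ P)) = subst (ParityOf _ _) (ℙ.+-assoc 1ℙ 1ℙ p) P
  ≈ₚ-dropPair x≈y (hit t≈x (miss t≉y _))    = contradiction (≈-trans t≈x x≈y) t≉y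
  ≈ₚ-dropPair x≈y (miss t≉x (hit t≈y _))    = contradiction (≈-trans t≈y (≈-sym x≈y)) t≉x
  ≈ₚ-dropPair x≈y (miss _ (miss _ P))       = P

module CoxeterWords {n : ℕ} (M : CoxeterMatrix n) where
  open CoxeterMatrix M using (m)
  open Coxeter M

  private variable
    u v w u′ v′ w′ r r′ t t′ : Word
    s : Fin (suc n)
    k a b : ℕ
    p q : Parity

  wordSetoid : Setoid 0ℓ 0ℓ
  wordSetoid = record
    { Carrier       = Word
    ; _≈_           = _≈_
    ; isEquivalence = record { refl = ≈-refl ; sym = ≈-sym ; trans = ≈-trans }
    }

  open Setoid wordSetoid using () renaming (reflexive to ≡⇒≈)
  open OccurrenceParity wordSetoid
  module ≈-Reasoning = SetoidReasoning wordSetoid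
  module Pointwise-Reasoning = SetoidReasoning (Pointwise.setoid wordSetoid)

  ++-congˡ : ∀ w → u ≈ v → w ++ u ≈ w ++ v
  ++-congˡ w ≈-refl            = ≈-refl
  ++-congˡ w (≈-sym e)         = ≈-sym (++-congˡ w e)
  ++-congˡ w (≈-trans e f)     = ≈-trans (++-congˡ w e) (++-congˡ w f)
  ++-congˡ w (cancel u i v)    = subst₂ _≈_ (++-assoc w u _) (++-assoc w u v) (cancel (w ++ u) i v)
  ++-congˡ w (braid u i j v h) = subst₂ _≈_ (++-assoc w u _) (++-assoc w u _) (braid (w ++ u) i j v h)

  ++-congʳ : ∀ w → u ≈ v → u ++ w ≈ v ++ w
  ++-congʳ w ≈-refl            = ≈-refl
  ++-congʳ w (≈-sym e)         = ≈-sym (++-congʳ w e)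
  ++-congʳ w (≈-trans e f)     = ≈-trans (++-congʳ w e) (++-congʳ w f)
  ++-congʳ w (cancel u i v)    =
    subst₂ _≈_ (sym (++-assoc u (i ∷ i ∷ v) w)) (sym (++-assoc u v w)) (cancel u i (v ++ w))
  ++-congʳ w (braid u i j v h) =
    subst₂ _≈_ (sym (reassoc (alt i j (m i j)))) (sym (reassoc (alt j i (m i j)))) (braid u i j (v ++ w) h)
    where
    reassoc : ∀ y → (u ++ y ++ v) ++ w ≡ u ++ y ++ v ++ w
    reassoc y = trans (++-assoc u (y ++ v) w) (cong (u ++_) (++-assoc y v w))

  ++-cong : u ≈ u′ → v ≈ v′ → u ++ v ≈ u′ ++ v′
  ++-cong {u′ = u′} {v = v} u≈u′ v≈v′ = ≈-trans (++-congʳ v u≈u′) (++-congˡ u′ v≈v′)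

  reverse-∷-++ : ∀ (c : Fin (suc n)) u w → reverse (c ∷ u) ++ w ≡ reverse u ++ c ∷ w
  reverse-∷-++ c u w = trans (cong (_++ w) (unfold-reverse c u)) (++-assoc (reverse u) (c ∷ []) w)

  inverseˡ-++ : ∀ u w → reverse u ++ u ++ w ≈ w
  inverseˡ-++ []      w = ≈-refl
  inverseˡ-++ (c ∷ u) w = begin
    reverse (c ∷ u) ++ c ∷ u ++ w ≡⟨ reverse-∷-++ c u _ ⟩
    reverse u ++ c ∷ c ∷ u ++ w   ≈⟨ cancel (reverse u) c (u ++ w) ⟩
    reverse u ++ u ++ w           ≈⟨ inverseˡ-++ u w ⟩
    w                             ∎
    where open ≈-Reasoning

  inverseʳ-++ : ∀ u w → u ++ reverse u ++ w ≈ w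
  inverseʳ-++ u w = subst (λ y → y ++ reverse u ++ w ≈ w) (reverse-involutive u) (inverseˡ-++ (reverse u) w)

  reverse-inverseˡ : ∀ u → reverse u ++ u ≈ []
  reverse-inverseˡ u = subst (λ y → reverse u ++ y ≈ []) (++-identityʳ u) (inverseˡ-++ u [])

  reverse-inverseʳ : ∀ u → u ++ reverse u ≈ []
  reverse-inverseʳ u = subst (λ y → u ++ y ≈ []) (++-identityʳ (reverse u)) (inverseʳ-++ u [])

  ++-cancelˡ : ∀ w → w ++ u ≈ w ++ v → u ≈ v
  ++-cancelˡ {u} {v} w e = begin
    u                      ≈⟨ inverseˡ-++ w u ⟨
    reverse w ++ w ++ u    ≈⟨ ++-congˡ (reverse w) e ⟩
    reverse w ++ w ++ v    ≈⟨ inverseˡ-++ w v ⟩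
    v                      ∎
    where open ≈-Reasoning

  ++-cancelʳ : ∀ w → u ++ w ≈ v ++ w → u ≈ v
  ++-cancelʳ {u} {v} w e = begin
    u                          ≈⟨ cancelled u ⟨
    u ++ w ++ reverse w        ≡⟨ ++-assoc u w _ ⟨
    (u ++ w) ++ reverse w      ≈⟨ ++-congʳ (reverse w) e ⟩
    (v ++ w) ++ reverse w      ≡⟨ ++-assoc v w _ ⟩
    v ++ w ++ reverse w        ≈⟨ cancelled v ⟩
    v                          ∎
    where
    open ≈-Reasoning
    cancelled : ∀ y → y ++ w ++ reverse w ≈ y
    cancelled y = ≈-trans (++-congˡ y (reverse-inverseʳ w)) (≡⇒≈ (++-identityʳ y))

  inverse-unique : u ++ v ≈ [] → u ≈ reverse v
  inverse-unique {u} {v} uv≈[] = ++-cancelʳ v (≈-trans uv≈[] (≈-sym (reverse-inverseˡ v)))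

  reverse-cong : u ≈ v → reverse u ≈ reverse v
  reverse-cong {u} u≈v = inverse-unique (≈-trans (++-congˡ (reverse u) (≈-sym u≈v)) (reverse-inverseˡ u))

  conj : Word → Word → Word
  conj w r = reverse w ++ r ++ w

  conj-congˡ : w ≈ w′ → conj w r ≈ conj w′ r
  conj-congˡ {r = r} w≈w′ = ++-cong (reverse-cong w≈w′) (++-congˡ r w≈w′)

  conj-congʳ : ∀ w → r ≈ r′ → conj w r ≈ conj w r′
  conj-congʳ w r≈r′ = ++-congˡ (reverse w) (++-congʳ w r≈r′)

  conj-injective : ∀ w → conj w r ≈ conj w r′ → r ≈ r′
  conj-injective w e = ++-cancelʳ w (++-cancelˡ (reverse w) e)

  conj-self : ∀ t → conj t t ≈ t
  conj-self t = inverseˡ-++ t t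

  conj-++ : ∀ u v r → conj (u ++ v) r ≡ conj v (conj u r)
  conj-++ u v r = begin
    reverse (u ++ v) ++ r ++ u ++ v            ≡⟨ cong (_++ r ++ u ++ v) (reverse-++ u v) ⟩
    (reverse v ++ reverse u) ++ r ++ u ++ v    ≡⟨ ++-assoc (reverse v) (reverse u) _ ⟩
    reverse v ++ reverse u ++ r ++ u ++ v      ≡⟨ cong (λ y → reverse v ++ reverse u ++ y) (++-assoc r u v) ⟨
    reverse v ++ reverse u ++ (r ++ u) ++ v    ≡⟨ cong (reverse v ++_) (++-assoc (reverse u) (r ++ u) v) ⟨
    reverse v ++ (reverse u ++ r ++ u) ++ v    ∎
    where open ≡-Reasoning

  conj-letter-twice : ∀ c r → conj (c ∷ []) (conj (c ∷ []) r) ≈ r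
  conj-letter-twice c r = begin
    conj (c ∷ []) (conj (c ∷ []) r) ≡⟨ conj-++ (c ∷ []) (c ∷ []) r ⟨
    conj (c ∷ c ∷ []) r             ≈⟨ conj-congˡ (cancel [] c []) ⟩
    r ++ []                         ≡⟨ ++-identityʳ r ⟩
    r                               ∎
    where open ≈-Reasoning

  ≈conj⇔ : conj v t′ ≈ t → ∀ r → t ≈ conj v r ⇔ t′ ≈ r
  ≈conj⇔ {v} vt′≈t r = mk⇔ (λ t≈vr → conj-injective v (≈-trans vt′≈t t≈vr))
                           (λ t′≈r → ≈-trans (≈-sym vt′≈t) (conj-congʳ v t′≈r))

  reflections : Word → List Word
  reflections []      = []
  reflections (c ∷ v) = conj v (c ∷ []) ∷ reflections v

  leftReflections : Word → List Word
  leftReflections []      = []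
  leftReflections (c ∷ v) = (c ∷ []) ∷ map (conj (c ∷ [])) (leftReflections v)

  reflections-++ : ∀ u v → reflections (u ++ v) ≡ map (conj v) (reflections u) ++ reflections v
  reflections-++ []      v = refl
  reflections-++ (c ∷ u) v = cong₂ _∷_ (conj-++ u v (c ∷ [])) (reflections-++ u v)

  reflections≈conj-leftReflections : ∀ w →
    Pointwise _≈_ (reflections w) (map (conj w) (leftReflections w))
  reflections≈conj-leftReflections []      = []
  reflections≈conj-leftReflections (c ∷ w) = head ∷ tail
    where
    [c] : Word
    [c] = c ∷ []
    head : conj w [c] ≈ conj (c ∷ w) [c]
    head = ≈-sym (≈-trans (≡⇒≈ (conj-++ [c] w [c])) (conj-congʳ w (cancel [] c [c])))
    tail : Pointwise _≈_ (reflections w) (map (conj (c ∷ w)) (map (conj [c]) (leftReflections w)))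
    tail = begin
      reflections w                                           ≈⟨ reflections≈conj-leftReflections w ⟩
      map (conj w) (leftReflections w)                        ≈⟨ Pointwise.map⁺ _ _ (Pointwise.refl twice) ⟩
      map (conj (c ∷ w) ∘ conj [c]) (leftReflections w)       ≡⟨ map-∘ (leftReflections w) ⟩
      map (conj (c ∷ w)) (map (conj [c]) (leftReflections w)) ∎
      where
      open Pointwise-Reasoning
      twice : ∀ {r} → conj w r ≈ conj (c ∷ w) (conj [c] r)
      twice {r} = ≈-trans (conj-congʳ w (≈-sym (conj-letter-twice c r)))
                          (≡⇒≈ (sym (conj-++ [c] w (conj [c] r))))

  altAt : Fin (suc n) → Fin (suc n) → ℕ → Fin (suc n)
  altAt i j zero    = i
  altAt i j (suc k) = altAt j i k

  alt-+ : ∀ i j k l → alt i j (k + l) ≡ alt i j k ++ alt (altAt i j k) (altAt j i k) l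
  alt-+ i j zero    l = refl
  alt-+ i j (suc k) l = cong (i ∷_) (alt-+ j i k l)

  altAt-even : ∀ i j k → altAt i j (k + k) ≡ i
  altAt-even i j zero    = refl
  altAt-even i j (suc k) rewrite +-suc k k = altAt-even i j k

  altAt-altAt : ∀ i j k → altAt (altAt i j k) (altAt j i k) k ≡ i
  altAt-altAt i j zero    = refl
  altAt-altAt i j (suc k) = altAt-altAt i j k

  alt-∷ʳ : ∀ i j k → alt i j (suc k) ≡ alt i j k ++ altAt i j k ∷ []
  alt-∷ʳ i j k = trans (cong (alt i j) (+-comm 1 k)) (alt-+ i j k 1)

  reverse-alt : ∀ i j k → reverse (alt j i k) ≡ alt (altAt i j k) (altAt j i k) k
  reverse-alt i j zero    = refl
  reverse-alt i j (suc k) = begin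
    reverse (j ∷ alt i j k)          ≡⟨ unfold-reverse j (alt i j k) ⟩
    reverse (alt i j k) ++ j ∷ []    ≡⟨ cong (_++ j ∷ []) (reverse-alt j i k) ⟩
    alt i′ j′ k ++ j ∷ []            ≡⟨ cong (λ c → alt i′ j′ k ++ c ∷ []) (altAt-altAt j i k) ⟨
    alt i′ j′ k ++ altAt i′ j′ k ∷ [] ≡⟨ alt-∷ʳ i′ j′ k ⟨
    alt i′ j′ (suc k)                ∎
    where
    open ≡-Reasoning
    i′ j′ : Fin (suc n)
    i′ = altAt j i k
    j′ = altAt i j k

  alt-double : ∀ i j k → alt i j (k + k) ≡ alt i j k ++ reverse (alt j i k)
  alt-double i j k = trans (alt-+ i j k k) (cong (alt i j k ++_) (sym (reverse-alt i j k)))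

  alt-odd-+ : ∀ i j k l → alt i j (suc (k + k) + l) ≡ alt i j (suc (k + k)) ++ alt j i l
  alt-odd-+ i j k l =
    trans (alt-+ i j (suc (k + k)) l)
          (cong₂ (λ c d → alt i j (suc (k + k)) ++ alt c d l) (altAt-even j i k) (altAt-even i j k))

  reverse-alt-odd : ∀ i j k → reverse (alt i j (suc (k + k))) ≡ alt i j (suc (k + k))
  reverse-alt-odd i j k =
    trans (reverse-alt j i (suc (k + k)))
          (cong₂ (λ c d → alt c d (suc (k + k))) (altAt-even i j k) (altAt-even j i k))

  leftReflections-alt : ∀ i j k → leftReflections (alt i j k) ≡ applyUpTo (λ l → alt i j (suc (l + l))) k
  leftReflections-alt i j zero    = refl
  leftReflections-alt i j (suc k) = cong ((i ∷ []) ∷_) (begin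
    map (conj (i ∷ [])) (leftReflections (alt j i k))               ≡⟨ cong (map _) (leftReflections-alt j i k) ⟩
    map (conj (i ∷ [])) (applyUpTo (λ l → alt j i (suc (l + l))) k) ≡⟨ map-applyUpTo _ _ k ⟩
    applyUpTo (λ l → conj (i ∷ []) (alt j i (suc (l + l)))) k       ≡⟨ applyUpTo-cong wrap k ⟩
    applyUpTo (λ l → alt i j (suc (suc l + suc l))) k               ∎)
    where
    open ≡-Reasoning
    wrap : ∀ l → conj (i ∷ []) (alt j i (suc (l + l))) ≡ alt i j (suc (suc l + suc l))
    wrap l = cong (i ∷_) (begin
      alt j i (suc (l + l)) ++ i ∷ []
        ≡⟨ cong (λ c → alt j i (suc (l + l)) ++ c ∷ []) (altAt-even i j l) ⟨
      alt j i (suc (l + l)) ++ altAt j i (suc (l + l)) ∷ []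
        ≡⟨ alt-∷ʳ j i (suc (l + l)) ⟨
      alt j i (suc (suc (l + l)))
        ≡⟨ cong (alt j i ∘ suc) (+-suc l l) ⟨
      alt j i (suc (l + suc l))
        ∎)
    applyUpTo-cong : ∀ {f g : ℕ → Word} → (∀ l → f l ≡ g l) → ∀ k → applyUpTo f k ≡ applyUpTo g k
    applyUpTo-cong f≗g zero    = refl
    applyUpTo-cong f≗g (suc k) = cong₂ _∷_ (f≗g 0) (applyUpTo-cong (f≗g ∘ suc) k)

  -- alt i j (2k+1) · alt j i (2l+1) = (i j)^K = 1 by the braid relation, and the second factor is a
  -- palindrome, hence its own inverse.
  alt-odd-≈ : ∀ i j k l → alt i j (suc (k + l)) ≈ alt j i (suc (k + l)) →
              alt i j (suc (k + k)) ≈ alt j i (suc (l + l))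
  alt-odd-≈ i j k l braid-ij = begin
    alt i j (suc (k + k))             ≈⟨ inverse-unique ijK+K≈[] ⟩
    reverse (alt j i (suc (l + l)))   ≡⟨ reverse-alt-odd j i l ⟩
    alt j i (suc (l + l))             ∎
    where
    open ≈-Reasoning
    K : ℕ
    K = suc (k + l)
    ijK+K≈[] : alt i j (suc (k + k)) ++ alt j i (suc (l + l)) ≈ []
    ijK+K≈[] = begin
      alt i j (suc (k + k)) ++ alt j i (suc (l + l)) ≡⟨ alt-odd-+ i j k (suc (l + l)) ⟨
      alt i j (suc (k + k) + suc (l + l))            ≡⟨ cong (alt i j) (halves k l) ⟩
      alt i j (K + K)                                ≡⟨ alt-double i j K ⟩
      alt i j K ++ reverse (alt j i K)               ≈⟨ ++-congʳ (reverse (alt j i K)) braid-ij ⟩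
      alt j i K ++ reverse (alt j i K)               ≈⟨ reverse-inverseʳ (alt j i K) ⟩
      []                                             ∎
      where
      open +-*-Solver
      halves : ∀ k l → suc (k + k) + suc (l + l) ≡ suc (k + l) + suc (k + l)
      halves = solve 2 (λ k l → (con 1 :+ k :+ k) :+ (con 1 :+ l :+ l)
                             := (con 1 :+ k :+ l) :+ (con 1 :+ k :+ l)) refl

  applyUpTo-applyDownFrom⁺ : ∀ {R : Word → Word → Set} {f g : ℕ → Word} k →
                             (∀ l l′ → suc (l + l′) ≡ k → R (f l) (g l′)) →
                             Pointwise R (applyUpTo f k) (applyDownFrom g k)
  applyUpTo-applyDownFrom⁺ zero    R-fg = []
  applyUpTo-applyDownFrom⁺ (suc k) R-fg =
    R-fg 0 k refl ∷ applyUpTo-applyDownFrom⁺ k (λ l l′ eq → R-fg (suc l) l′ (cong suc eq))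

  leftReflections-braid : ∀ i j k → alt i j k ≈ alt j i k →
                          Pointwise _≈_ (leftReflections (alt i j k)) (reverse (leftReflections (alt j i k)))
  leftReflections-braid i j k braid-ij =
    subst₂ (Pointwise _≈_) (sym (leftReflections-alt i j k))
           (sym (trans (cong reverse (leftReflections-alt j i k)) (reverse-applyUpTo _ k)))
           (applyUpTo-applyDownFrom⁺ k λ l l′ eq →
              alt-odd-≈ i j l l′ (subst (λ K → alt i j K ≈ alt j i K) (sym eq) braid-ij))

  reflections-braid : ∀ i j k → alt i j k ≈ alt j i k →
                      Pointwise _≈_ (reflections (alt i j k)) (reverse (reflections (alt j i k)))
  reflections-braid i j k braid-ij = begin
    reflections A                                ≈⟨ reflections≈conj-leftReflections A ⟩
    map (conj A) (leftReflections A)             ≈⟨ Pointwise.map⁺ _ _ (Pointwise.map (conj-congʳ A) left-braid) ⟩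
    map (conj A) (reverse (leftReflections A′))  ≈⟨ Pointwise.map⁺ _ _ (Pointwise.refl (conj-congˡ braid-ij)) ⟩
    map (conj A′) (reverse (leftReflections A′)) ≡⟨ reverse-map (conj A′) (leftReflections A′) ⟩
    reverse (map (conj A′) (leftReflections A′)) ≈⟨ Pointwise.reverse⁺ (reflections≈conj-leftReflections A′) ⟨
    reverse (reflections A′)                     ∎
    where
    open Pointwise-Reasoning
    A A′ : Word
    A  = alt i j k
    A′ = alt j i k
    left-braid : Pointwise _≈_ (leftReflections A) (reverse (leftReflections A′))
    left-braid = leftReflections-braid i j k braid-ij

  reflections-++-cong : ∀ u → w ≈ w′ → reflections w ≈ₚ reflections w′ →
                        reflections (u ++ w) ≈ₚ reflections (u ++ w′)
  reflections-++-cong {w} {w′} u w≈w′ w≈ₚw′ {t} {p} =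
    subst (λ zs → ParityOf t zs p) (sym (reflections-++ u w′))
    ∘ ≈ₚ-++ (≈ₚ-Pointwise (Pointwise.map⁺ _ _ (Pointwise.refl (conj-congˡ w≈w′)))) w≈ₚw′
    ∘ subst (λ zs → ParityOf t zs p) (reflections-++ u w)

  reflections-cancel : ∀ i v → reflections (i ∷ i ∷ v) ≈ₚ reflections v
  reflections-cancel i v = ≈ₚ-dropPair (begin
    conj (i ∷ v) (i ∷ [])         ≡⟨ conj-++ (i ∷ []) v (i ∷ []) ⟩
    conj v (i ∷ i ∷ i ∷ [])       ≈⟨ conj-congʳ v (cancel [] i (i ∷ [])) ⟩
    conj v (i ∷ [])               ∎)
    where open ≈-Reasoning

  reflections-braid-++ : ∀ i j k v → alt i j k ≈ alt j i k →
                         reflections (alt i j k ++ v) ≈ₚ reflections (alt j i k ++ v)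
  reflections-braid-++ i j k v braid-ij {t} {p} =
    subst (λ zs → ParityOf t zs p) (sym (reflections-++ (alt j i k) v))
    ∘ ≈ₚ-++ alternating (λ P → P)
    ∘ subst (λ zs → ParityOf t zs p) (reflections-++ (alt i j k) v)
    where
    alternating : map (conj v) (reflections (alt i j k)) ≈ₚ map (conj v) (reflections (alt j i k))
    alternating =
      subst (λ zs → ParityOf _ zs _) (reverse-involutive _)
      ∘ ≈ₚ-reverse
      ∘ subst (λ zs → ParityOf _ zs _) (reverse-map (conj v) (reflections (alt j i k)))
      ∘ ≈ₚ-Pointwise (Pointwise.map⁺ _ _ (Pointwise.map (conj-congʳ v) (reflections-braid i j k braid-ij)))

  reflections-parity-cong : u ≈ v → ParityOf t (reflections u) p → ParityOf t (reflections v) q → p ≡ q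
  reflections-parity-cong ≈-refl            P Q = parityOf-functional P Q
  reflections-parity-cong (≈-sym e)         P Q = sym (reflections-parity-cong e Q P)
  reflections-parity-cong {t = t} {p} {q} (≈-trans {v = w} e f) P Q =
    decidable-stable (p ℙ.≟ q) λ p≢q → parityOf-¬¬exists t (reflections w) λ (r , R) →
      p≢q (trans (reflections-parity-cong e P R) (reflections-parity-cong f R Q))
  reflections-parity-cong (cancel u i v)    P Q =
    parityOf-functional (reflections-++-cong u (cancel [] i v) (reflections-cancel i v) P) Q
  reflections-parity-cong (braid u i j v h) P Q =
    parityOf-functional (reflections-++-cong u (braid [] i j v h) (reflections-braid-++ i j _ v braid-ij) P) Q
    where
    braid-ij : alt i j (m i j) ≈ alt j i (m i j)
    braid-ij = subst₂ _≈_ (++-identityʳ _) (++-identityʳ _) (braid [] i j [] h)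

  reflections-parity-++⁺ : ∀ u → conj v t′ ≈ t →
                           ParityOf t′ (reflections u) p → ParityOf t (reflections v) q →
                           ParityOf t (reflections (u ++ v)) (p ℙ.+ q)
  reflections-parity-++⁺ {v} {t = t} u vt′≈t P Q =
    subst (λ zs → ParityOf t zs _) (sym (reflections-++ u v))
          (parityOf-++⁺ (parityOf-map⁺ (≈conj⇔ {v = v} vt′≈t) P) Q)

  reflections-parity-++⁻ : ∀ u → conj v t′ ≈ t → ParityOf t (reflections (u ++ v)) p →
                           ∃₂ λ q r → ParityOf t′ (reflections u) q × ParityOf t (reflections v) r
                                    × p ≡ q ℙ.+ r
  reflections-parity-++⁻ {v} {t = t} u vt′≈t P
    with parityOf-++⁻ (map (conj v) (reflections u))
                      (subst (λ zs → ParityOf t zs _) (reflections-++ u v) P)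
  ... | q , r , Q , R , p≡q+r = q , r , parityOf-map⁻ (≈conj⇔ {v = v} vt′≈t) (reflections u) Q , R , p≡q+r

  conj-reverse-letter : ∀ x s → conj (reverse x) (s ∷ []) ≡ reflection x s
  conj-reverse-letter x s = cong (_++ s ∷ reverse x) (reverse-involutive x)

  conj-∷-reflection : ∀ x s → conj (s ∷ reverse x) (s ∷ []) ≈ reflection x s
  conj-∷-reflection x s = begin
    conj (s ∷ reverse x) (s ∷ [])     ≡⟨ conj-++ (s ∷ []) (reverse x) (s ∷ []) ⟩
    conj (reverse x) (s ∷ s ∷ s ∷ []) ≈⟨ conj-congʳ (reverse x) (cancel [] s (s ∷ [])) ⟩
    conj (reverse x) (s ∷ [])         ≡⟨ conj-reverse-letter x s ⟩
    reflection x s                    ∎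
    where open ≈-Reasoning

  -- Split t = x s x⁻¹ as x · (s x⁻¹): the first entry of the second part is t itself, and the
  -- remaining entries cancel in parity against those of x, since x x⁻¹ = 1 has no reflections.
  reflection-parity-self : ∀ x s → ParityOf (reflection x s) (reflections (reflection x s)) p → p ≡ 1ℙ
  reflection-parity-self {p} x s P with reflections-parity-++⁻ x (conj-∷-reflection x s) P
  ... | q , _ , Q , hit {p = r} _ R , p≡q+[1+r] = begin
    p                     ≡⟨ p≡q+[1+r] ⟩
    q ℙ.+ (1ℙ ℙ.+ r)      ≡⟨ swap q r ⟩
    1ℙ ℙ.+ (q ℙ.+ r)      ≡⟨ cong (1ℙ ℙ.+_) q+r≡0ℙ ⟩
    1ℙ                    ∎
    where
    open ≡-Reasoning
    q+r≡0ℙ : q ℙ.+ r ≡ 0ℙ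
    q+r≡0ℙ = reflections-parity-cong (reverse-inverseʳ x)
               (reflections-parity-++⁺ x (≡⇒≈ (conj-reverse-letter x s)) Q R) []
    swap : ∀ q r → q ℙ.+ (1ℙ ℙ.+ r) ≡ 1ℙ ℙ.+ (q ℙ.+ r)
    swap 0ℙ r = refl
    swap 1ℙ r = refl
  ... | _ , _ , _ , miss t≉t _ , _ = contradiction (≡⇒≈ (sym (conj-reverse-letter x s))) t≉t

  reflections-deletion : Any (t ≈_) (reflections v) → ∃ λ u → u ⊆ v × length u < length v × v ++ t ≈ u
  reflections-deletion {t} {c ∷ v} (here t≈tᵢ) = v , c ∷ʳ ⊆-refl , ≤-refl , (begin
    c ∷ v ++ t                       ≈⟨ ++-congˡ (c ∷ v) t≈tᵢ ⟩
    c ∷ v ++ reverse v ++ c ∷ v      ≈⟨ ++-congˡ (c ∷ []) (inverseʳ-++ v (c ∷ v)) ⟩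
    c ∷ c ∷ v                        ≈⟨ cancel [] c v ⟩
    v                                ∎)
    where open ≈-Reasoning
  reflections-deletion {t} {c ∷ v} (there t∈) with reflections-deletion t∈
  ... | u , u⊆v , |u|<|v| , vt≈u = c ∷ u , refl ∷ u⊆v , s≤s |u|<|v| , ++-congˡ (c ∷ []) vt≈u

  reverse-reflection : ∀ x s → reverse (reflection x s) ≡ reflection x s
  reverse-reflection x s = begin
    reverse (x ++ s ∷ reverse x)          ≡⟨ reverse-++ x (s ∷ reverse x) ⟩
    reverse (s ∷ reverse x) ++ reverse x  ≡⟨ reverse-∷-++ s (reverse x) (reverse x) ⟩
    reverse (reverse x) ++ s ∷ reverse x  ≡⟨ conj-reverse-letter x s ⟩
    x ++ s ∷ reverse x                    ∎
    where open ≡-Reasoning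

  reflection-involutive : ∀ x s → reflection x s ++ reflection x s ≈ []
  reflection-involutive x s =
    subst (λ y → reflection x s ++ y ≈ []) (reverse-reflection x s) (reverse-inverseʳ (reflection x s))

  bruhatStep-subword : BruhatStep u v → v′ ≈ v → ¬ ¬ ∃ λ u′ → u′ ⊆ v′ × u′ ≈ u
  bruhatStep-subword {u} {v} {v′} (x , s , v≈ut , a , b , ((r , r≈u , |r|≡a) , _) , (_ , v-minimal) , a<b)
                     v′≈v no-subword =
    parityOf-¬¬exists t₀ (reflections r) λ where
      (1ℙ , P) → r-not-deletable P
      (0ℙ , P) → v′-deletable P λ P′ → no-subword (subword P′)
    where
    t₀ : Word
    t₀ = reflection x s
    rt≈v : r ++ t₀ ≈ v
    rt≈v = ≈-trans (++-congʳ t₀ r≈u) (≈-sym v≈ut)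

    r-not-deletable : ¬ ParityOf t₀ (reflections r) 1ℙ
    r-not-deletable P with reflections-deletion (parityOf-1ℙ⇒Any P)
    ... | r′ , _ , |r′|<|r| , rt≈r′ = <-asym a<b (begin-strict
      b           ≤⟨ v-minimal _ (r′ , ≈-trans (≈-sym rt≈r′) rt≈v , refl) ⟩
      length r′   <⟨ |r′|<|r| ⟩
      length r    ≡⟨ |r|≡a ⟩
      a           ∎)
      where open ≤-Reasoning

    v′-deletable : ParityOf t₀ (reflections r) 0ℙ → ¬ ¬ ParityOf t₀ (reflections v′) 1ℙ
    v′-deletable P k =
      parityOf-¬¬exists t₀ (reflections t₀) λ (_ , Q) →
      parityOf-¬¬exists t₀ (reflections v′) λ (_ , P′) →
      k (subst (ParityOf t₀ _) (parity≡1ℙ Q P′) P′)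
      where
      parity≡1ℙ : ∀ {q p′} → ParityOf t₀ (reflections t₀) q → ParityOf t₀ (reflections v′) p′ → p′ ≡ 1ℙ
      parity≡1ℙ {q} {p′} Q P′ = begin
        p′        ≡⟨ reflections-parity-cong rt≈v′ (reflections-parity-++⁺ r (conj-self t₀) P Q) P′ ⟨
        0ℙ ℙ.+ q  ≡⟨ reflection-parity-self x s Q ⟩
        1ℙ        ∎
        where
        open ≡-Reasoning
        rt≈v′ : r ++ t₀ ≈ v′
        rt≈v′ = ≈-trans rt≈v (≈-sym v′≈v)

    subword : ParityOf t₀ (reflections v′) 1ℙ → ∃ λ u′ → u′ ⊆ v′ × u′ ≈ u
    subword P′ with reflections-deletion (parityOf-1ℙ⇒Any P′)
    ... | u′ , u′⊆v′ , _ , v′t≈u′ = u′ , u′⊆v′ , (begin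
      u′              ≈⟨ v′t≈u′ ⟨
      v′ ++ t₀        ≈⟨ ++-congʳ t₀ (≈-trans v′≈v v≈ut) ⟩
      (u ++ t₀) ++ t₀ ≡⟨ ++-assoc u t₀ t₀ ⟩
      u ++ t₀ ++ t₀   ≈⟨ ++-congˡ u (reflection-involutive x s) ⟩
      u ++ []         ≡⟨ ++-identityʳ u ⟩
      u               ∎)
      where open ≈-Reasoning

  bruhat-subword : BruhatLt u v → v′ ≈ v → ¬ ¬ ∃ λ u′ → u′ ⊆ v′ × u′ ≈ u
  bruhat-subword [ u<v ]        v′≈v = bruhatStep-subword u<v v′≈v
  bruhat-subword (u<w ∷ w<v) v′≈v k =
    bruhat-subword w<v v′≈v λ (w′ , w′⊆v′ , w′≈w) →
    bruhatStep-subword u<w w′≈w λ (u′ , u′⊆w′ , u′≈u) →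
    k (u′ , ⊆-trans u′⊆w′ w′⊆v′ , u′≈u)

  countNon0-mono : u ⊆ v → countNon0 u ≤ countNon0 v
  countNon0-mono []                      = z≤n
  countNon0-mono (zero  ∷ʳ u⊆v)          = countNon0-mono u⊆v
  countNon0-mono (suc _ ∷ʳ u⊆v)          = m≤n⇒m≤1+n (countNon0-mono u⊆v)
  countNon0-mono {zero  ∷ _} (refl ∷ u⊆v) = countNon0-mono u⊆v
  countNon0-mono {suc _ ∷ _} (refl ∷ u⊆v) = s≤s (countNon0-mono u⊆v)

  infix 4 _≤ν_
  _≤ν_ : ℕ → Word → Set
  a ≤ν w = ∀ w′ → w′ ≈ w → a ≤ countNon0 w′

  ≤ν-bruhat : a ≤ν u → BruhatLt u v → a ≤ν v
  ≤ν-bruhat {a} a≤νu u<v v′ v′≈v = decidable-stable (a ≤? countNon0 v′) λ a≰v′ →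
    bruhat-subword u<v v′≈v λ (u′ , u′⊆v′ , u′≈u) →
    a≰v′ (≤-trans (a≤νu u′ u′≈u) (countNon0-mono u′⊆v′))

  Nu⇒≤ν : Nu w a → a ≤ν w
  Nu⇒≤ν (_ , ν-minimal) w′ w′≈w = ν-minimal _ (w′ , w′≈w , refl)

  ≤ν-Nu : a ≤ν w → Nu w b → a ≤ b
  ≤ν-Nu a≤νw ((w′ , w′≈w , ν≡b) , _) = subst (_ ≤_) ν≡b (a≤νw w′ w′≈w)

  ν-mono : BruhatLt w w′ → Nu w a → Nu w′ b → a ≤ b
  ν-mono w<w′ νw = ≤ν-Nu (≤ν-bruhat (Nu⇒≤ν νw) w<w′)

  descent⇒bruhatLt : LenLt (w ++ s ∷ []) w → BruhatLt (w ++ s ∷ []) w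
  descent⇒bruhatLt {w} {s} ws<w = [ [] , s , ≈-sym ws·s≈w , ws<w ]
    where
    ws·s≈w : (w ++ s ∷ []) ++ s ∷ [] ≈ w
    ws·s≈w = begin
      (w ++ s ∷ []) ++ s ∷ [] ≡⟨ ++-assoc w (s ∷ []) (s ∷ []) ⟩
      w ++ s ∷ s ∷ []         ≈⟨ cancel w s [] ⟩
      w ++ []                 ≡⟨ ++-identityʳ w ⟩
      w                       ∎
      where open ≈-Reasoning

  length-alt-swap : ∀ i j k → length (alt i j k) ≡ length (alt j i k)
  length-alt-swap i j zero    = refl
  length-alt-swap i j (suc k) = cong suc (length-alt-swap j i k)

  length-++-cong : ∀ u v → length w ≡ length w′ → length (u ++ w ++ v) ≡ length (u ++ w′ ++ v)
  length-++-cong {w} {w′} []      v |w|≡|w′| =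
    trans (length-++ w) (trans (cong (_+ length v) |w|≡|w′|) (sym (length-++ w′)))
  length-++-cong          (_ ∷ u) v |w|≡|w′| = cong suc (length-++-cong u v |w|≡|w′|)

  parity-length-cong : u ≈ v → parity (length u) ≡ parity (length v)
  parity-length-cong ≈-refl            = refl
  parity-length-cong (≈-sym e)         = sym (parity-length-cong e)
  parity-length-cong (≈-trans e f)     = trans (parity-length-cong e) (parity-length-cong f)
  parity-length-cong (cancel u i v)    =
    cong parity (trans (length-++-sucʳ u i _) (cong suc (length-++-sucʳ u i v)))
  parity-length-cong (braid u i j v h) = cong parity (length-++-cong u v (length-alt-swap i j (m i j)))

  Even⇒parity≡0ℙ : Even k → parity k ≡ 0ℙ
  Even⇒parity≡0ℙ even-zero   = refl
  Even⇒parity≡0ℙ (even-ss e) = Even⇒parity≡0ℙ e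

  parity≡0ℙ⇒Even : ∀ k → parity k ≡ 0ℙ → Even k
  parity≡0ℙ⇒Even zero          _ = even-zero
  parity≡0ℙ⇒Even (suc zero)    ()
  parity≡0ℙ⇒Even (suc (suc k)) p≡0ℙ = even-ss (parity≡0ℙ⇒Even k p≡0ℙ)

  InWplus-cong : u ≈ v → InWplus u → InWplus v
  InWplus-cong {u} {v} u≈v u⁺ =
    parity≡0ℙ⇒Even (length v) (trans (sym (parity-length-cong u≈v)) (Even⇒parity≡0ℙ u⁺))

  countNon0-++ : ∀ u v → countNon0 (u ++ v) ≡ countNon0 u + countNon0 v
  countNon0-++ []          v = refl
  countNon0-++ (zero  ∷ u) v = countNon0-++ u v
  countNon0-++ (suc _ ∷ u) v = cong suc (countNon0-++ u v)

  countNon0-expandRWord : ∀ ls → countNon0 (expandRWord ls) ≡ length ls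
  countNon0-expandRWord []              = refl
  countNon0-expandRWord ((_ , true)  ∷ ls) = cong suc (countNon0-expandRWord ls)
  countNon0-expandRWord ((_ , false) ∷ ls) = cong suc (countNon0-expandRWord ls)

  -- s_{i+1} s_{j+1} = (s_{i+1} s₀)(s₀ s_{j+1}) = r_{i+1}⁻¹ r_{j+1}
  letterPair : Fin (suc n) → Fin (suc n) → List RLetter
  letterPair zero    zero    = []
  letterPair zero    (suc j) = (j , true) ∷ []
  letterPair (suc i) zero    = (i , false) ∷ []
  letterPair (suc i) (suc j) = (i , false) ∷ (j , true) ∷ []

  expandRWord-letterPair : ∀ i j → expandRWord (letterPair i j) ≈ i ∷ j ∷ []
  expandRWord-letterPair zero    zero    = ≈-sym (cancel [] zero [])
  expandRWord-letterPair zero    (suc j) = ≈-refl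
  expandRWord-letterPair (suc i) zero    = ≈-refl
  expandRWord-letterPair (suc i) (suc j) = cancel (suc i ∷ []) zero (suc j ∷ [])

  length-letterPair : ∀ i j → length (letterPair i j) ≡ countNon0 (i ∷ j ∷ [])
  length-letterPair zero    zero    = refl
  length-letterPair zero    (suc j) = refl
  length-letterPair (suc i) zero    = refl
  length-letterPair (suc i) (suc j) = refl

  InWplus⇒RWord : ∀ w → InWplus w → ∃ λ ls → expandRWord ls ≈ w × length ls ≡ countNon0 w
  InWplus⇒RWord []          even-zero   = [] , ≈-refl , refl
  InWplus⇒RWord (i ∷ j ∷ w) (even-ss w⁺) with InWplus⇒RWord w w⁺
  ... | ls , ls≈w , |ls|≡ν = letterPair i j ++ ls , expand≈ , length≡
    where
    expand≈ : expandRWord (letterPair i j ++ ls) ≈ i ∷ j ∷ w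
    expand≈ = ≈-trans (≡⇒≈ (concatMap-++ expandR (letterPair i j) ls))
                      (++-cong (expandRWord-letterPair i j) ls≈w)
    length≡ : length (letterPair i j ++ ls) ≡ countNon0 (i ∷ j ∷ w)
    length≡ = trans (length-++ (letterPair i j))
                (trans (cong₂ _+_ (length-letterPair i j) |ls|≡ν) (sym (countNon0-++ (i ∷ j ∷ []) w)))

  LenR⇒≤ν : InWplus w → LenR w a → a ≤ν w
  LenR⇒≤ν w⁺ (_ , lenR-minimal) w′ w′≈w with InWplus⇒RWord w′ (InWplus-cong (≈-sym w′≈w) w⁺)
  ... | ls , ls≈w′ , |ls|≡ν = subst (_ ≤_) |ls|≡ν (lenR-minimal _ (ls , ≈-trans ls≈w′ w′≈w , refl))

  ≤ν-LenR : a ≤ν w → LenR w b → a ≤ b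
  ≤ν-LenR a≤νw ((ls , ls≈w , |ls|≡b) , _) =
    subst (_ ≤_) (trans (countNon0-expandRWord ls) |ls|≡b) (a≤νw (expandRWord ls) ls≈w)

  lenR-mono : InWplus w → BruhatLt w w′ → LenR w a → LenR w′ b → a ≤ b
  lenR-mono w⁺ w<w′ ℓw = ≤ν-LenR (≤ν-bruhat (LenR⇒≤ν w⁺ ℓw) w<w′)

proposition2p16 : ∀ (n : ℕ) (M : CoxeterMatrix n) → let open Coxeter M in
    (∀ (w w' : Word) → BruhatLt w w' → ∀ a b → Nu w a → Nu w' b → a ≤ b)
    × (∀ (s : Fin (suc n)) (w : Word) → LenLt (w ++ s ∷ []) w →
         ∀ a b → Nu (w ++ s ∷ []) a → Nu w b → a ≤ b)
    × (∀ (w w' : Word) → InWplus w → InWplus w' → BruhatLt w w' →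
         ∀ a b → LenR w a → LenR w' b → a ≤ b)
proposition2p16 n M =
    (λ _ _ w<w′ _ _ → ν-mono w<w′)
  , (λ _ _ ws<w _ _ → ν-mono (descent⇒bruhatLt ws<w))
  , (λ _ _ w⁺ _ w<w′ _ _ → lenR-mono w⁺ w<w′)
  where open CoxeterWords M
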